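{- For every tree $T$, $Tr(T)-1\le TTr(T)\le Tr(T)$.
   Context: All graphs are finite and simple. For disjoint vertex sets $A,B$, $A$ dominates $B$ if every vertex of $B$ has a neighbour in $A$. A transitive partition of order $k$ of $G=(V,E)$ is a partition $\{V_1,\dots,V_k\}$ of $V$ into nonempty sets with $V_i$ dominating $V_j$ for all $1\le i<j\le k$; the transitivity $Tr(G)$ is the maximum such $k$. A tournament transitive partition additionally requires that $V_j$ does not dominate $V_i$ for all $i<j$; the tournament transitivity $TTr(G)$ is the maximum order of such a partition. -}

module Defs where

open import Data.Nat using (ℕ; _≤_; _∸_)
open import Data.Fin using (Fin; _<_)
open import Data.Bool using (Bool; true; false)
open import Data.List using (List; length; _++_; take)
open import Data.List.Relation.Unary.Unique.Propositional using (Unique)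
open import Data.List.Relation.Unary.Linked using (Linked)
open import Data.Product using (Σ; ∃; _×_)
open import Data.Empty using (⊥)
open import Relation.Nullary using (¬_)
open import Relation.Binary.PropositionalEquality using (_≡_)
open import Function.Definitions using (Surjective)

record Graph (n : ℕ) : Set where
  field
    adj   : Fin n → Fin n → Bool
    sym   : ∀ u v → adj u v ≡ adj v u
    irrefl : ∀ v → adj v v ≡ false

open Graph public

module _ {n : ℕ} (G : Graph n) where

  Adj : Fin n → Fin n → Set
  Adj u v = adj G u v ≡ true

  data Walk : Fin n → Fin n → Set where
    here : ∀ {u} → Walk u u
    step : ∀ {u w v} → Adj u w → Walk w v → Walk u v

  Connected : Set
  Connected = ∀ u v → Walk u v

  -- a cycle: at least 3 distinct vertices, consecutive ones adjacent,
  -- and the last adjacent to the first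
  HasCycle : Set
  HasCycle = Σ (List (Fin n)) λ xs →
    (3 ≤ length xs) × Unique xs × Linked Adj (xs ++ take 1 xs)

  IsTree : Set
  IsTree = (1 ≤ n) × Connected × ¬ HasCycle

  -- A partition {V_1,...,V_k} of V into nonempty sets, given by the class map
  -- f (V_i = f⁻¹(i)); nonemptiness of classes = surjectivity of f.
  IsPartition : (k : ℕ) → (Fin n → Fin k) → Set
  IsPartition k f = Surjective _≡_ _≡_ f

  Dominates : {k : ℕ} → (Fin n → Fin k) → Fin k → Fin k → Set
  Dominates f i j = ∀ v → f v ≡ j → ∃ λ u → f u ≡ i × Adj u v

  IsTransitivePartition : (k : ℕ) → (Fin n → Fin k) → Set
  IsTransitivePartition k f =
    IsPartition k f × (∀ i j → i < j → Dominates f i j)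

  IsTournamentTransitivePartition : (k : ℕ) → (Fin n → Fin k) → Set
  IsTournamentTransitivePartition k f =
    IsTransitivePartition k f × (∀ i j → i < j → ¬ Dominates f j i)

  HasTransitivePartition : ℕ → Set
  HasTransitivePartition k = Σ (Fin n → Fin k) (IsTransitivePartition k)

  HasTournamentTransitivePartition : ℕ → Set
  HasTournamentTransitivePartition k = Σ (Fin n → Fin k) (IsTournamentTransitivePartition k)

  IsTransitivity : ℕ → Set
  IsTransitivity t = HasTransitivePartition t × (∀ k → HasTransitivePartition k → k ≤ t)

  IsTournamentTransitivity : ℕ → Set
  IsTournamentTransitivity t =
    HasTournamentTransitivePartition t × (∀ k → HasTournamentTransitivePartition k → k ≤ t)

{-# OPTIONS --safe #-}
-- Let x lie in the top class of a transitive partition V₀, …, V_{k+1} of a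
-- forest, and let S be the set of vertices reachable from x along paths on
-- which the class strictly decreases. Keeping V_t ∩ S for t < k, making {x}
-- the new class k and putting every other vertex (in particular V_k ∩ S)
-- into class 0 gives a transitive partition of order k + 1, since a vertex of
-- S has a neighbour in S in every lower class. If the new class j dominated
-- the new class i < j, we would get a cycle: for j < k, a class-i neighbour y
-- of x would have a neighbour u in V_j ∩ S, closing x ⇝ u – y – x; for j = k,
-- where the new class is {x}, a class-i neighbour z of a class-k neighbour y
-- of x would be adjacent to x.
module Submission where

open import Defs
open import Data.Nat using (ℕ; _≤_; _∸_)
open import Data.Product using (_×_)

open import Data.Nat using (suc; _+_; _<_; _<?_; z≤n; s≤s)
open import Data.Nat.Properties
  using ( ≤-refl; ≤-reflexive; ≤-trans; <⇒≤; <-trans; <-≤-trans; ≤-<-trans; <-irrefl; n≮0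
        ; m<n⇒m<1+n; m<1+n⇒m<n∨m≡n; m≤n⇒m≤1+n)
open import Data.Fin as Fin using (Fin; toℕ; fromℕ; fromℕ<)
open import Data.Fin.Properties using (toℕ-injective; toℕ<n; toℕ-fromℕ; toℕ-fromℕ<; any?)
open import Data.Bool using (true)
import Data.Bool.Properties as Bool
open import Data.List using (List; []; _∷_; length; _++_)
open import Data.List.Relation.Unary.All as All using (All; []; _∷_)
open import Data.List.Relation.Unary.AllPairs using ([]; _∷_)
open import Data.List.Relation.Unary.Unique.Propositional using (Unique)
open import Data.List.Relation.Unary.Linked using (Linked; [-]; _∷_)
open import Data.Product using (∃; _,_; proj₁; proj₂)
open import Data.Sum using (inj₁; inj₂)
open import Data.Empty using (⊥-elim)
open import Function using (_∘_)
open import Relation.Nullary using (¬_; Dec; yes; no)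
open import Relation.Nullary.Decidable using (map′; _×-dec_)
open import Relation.Binary.PropositionalEquality
  using (_≡_; refl; trans; cong; subst; subst₂) renaming (sym to ≡-sym)

Adj-sym : ∀ {n} (G : Graph n) {u v} → Adj G u v → Adj G v u
Adj-sym G {u} {v} a = trans (Graph.sym G v u) a

Adj? : ∀ {n} (G : Graph n) u v → Dec (Adj G u v)
Adj? G u v = adj G u v Bool.≟ true

module Descents {n : ℕ} (G : Graph n) (rank : Fin n → ℕ) where

  data Descent : Fin n → Fin n → Set where
    done : ∀ {v} → Descent v v
    down : ∀ {p q v} → Adj G p q → rank q < rank p → Descent q v → Descent p v

  snoc : ∀ {p u v} → Descent p u → Adj G u v → rank v < rank u → Descent p v
  snoc done         a l = down a l done
  snoc (down b m d) a l = down b m (snoc d a l)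

  vertices : ∀ {p v} → Descent p v → List (Fin n)
  vertices {p} done         = p ∷ []
  vertices {p} (down _ _ d) = p ∷ vertices d

  vertices-≤ : ∀ {p v} (d : Descent p v) → All (λ w → rank w ≤ rank p) (vertices d)
  vertices-≤ done         = ≤-refl ∷ []
  vertices-≤ (down _ l d) = ≤-refl ∷ All.map (λ w≤q → ≤-trans w≤q (<⇒≤ l)) (vertices-≤ d)

  vertices-unique : ∀ {p v} (d : Descent p v) → Unique (vertices d)
  vertices-unique done         = [] ∷ []
  vertices-unique (down _ l d) =
    All.map (λ w≤q p≡w → <-irrefl (cong rank (≡-sym p≡w)) (≤-<-trans w≤q l)) (vertices-≤ d)
    ∷ vertices-unique d

  vertices-linked : ∀ {p v w} (d : Descent p v) → Adj G v w → Linked (Adj G) (vertices d ++ w ∷ [])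
  vertices-linked done                    a = a ∷ [-]
  vertices-linked (down b _ done)         a = b ∷ a ∷ [-]
  vertices-linked (down b _ d@(down _ _ _)) a = b ∷ vertices-linked d a

  2≤|vertices-snoc| : ∀ {p u v} (d : Descent p u) (a : Adj G u v) (l : rank v < rank u) →
                      2 ≤ length (vertices (snoc d a l))
  2≤|vertices-snoc| done         a l = s≤s (s≤s z≤n)
  2≤|vertices-snoc| (down _ _ d) a l = m≤n⇒m≤1+n (2≤|vertices-snoc| d a l)

  descent-closed⇒cycle : ∀ {x u y} → Descent x u → rank u < rank x →
                         Adj G u y → rank y < rank u → Adj G y x → HasCycle G
  descent-closed⇒cycle done         u<x _ _ _ = ⊥-elim (<-irrefl refl u<x)
  descent-closed⇒cycle (down b m d) _   a l c =
    vertices d′ , s≤s (2≤|vertices-snoc| d a l) , vertices-unique d′ , vertices-linked d′ c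
    where d′ = down b m (snoc d a l)

  descent? : ∀ p v → Dec (Descent p v)
  descent? p v = descent<? (suc (rank p)) p v ≤-refl
    where
    descent<? : ∀ b p v → rank p < b → Dec (Descent p v)
    descent<? (suc b) p v (s≤s p≤b) with p Fin.≟ v
    ... | yes refl = yes done
    ... | no p≢v   = map′ (λ (_ , a , l , d) → down a l d) first-step (any? first-step?)
      where
      first-step : Descent p v → ∃ λ q → Adj G p q × rank q < rank p × Descent q v
      first-step done         = ⊥-elim (p≢v refl)
      first-step (down a l d) = _ , a , l , d

      first-step? : ∀ q → Dec (Adj G p q × rank q < rank p × Descent q v)
      first-step? q with rank q <? rank p
      ... | no q≮p  = no (q≮p ∘ proj₁ ∘ proj₂)
      ... | yes q<p = map′ (λ (a , d) → a , q<p , d) (λ (a , _ , d) → a , d)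
                          (Adj? G p q ×-dec descent<? b q v (<-≤-trans q<p p≤b))

neighbour-below : ∀ {n k} (G : Graph n) {c : Fin n → Fin k} →
                  (∀ i j → i Fin.< j → Dominates G c i j) →
                  ∀ v {t} → t < toℕ (c v) → ∃ λ u → toℕ (c u) ≡ t × Adj G u v
neighbour-below G {c} dominates v {t} t<cv
  with dominates (fromℕ< t<k) (c v) (subst (_< toℕ (c v)) (≡-sym (toℕ-fromℕ< t<k)) t<cv) v refl
  where t<k = <-trans t<cv (toℕ<n (c v))
... | u , cu≡ , a = u , trans (cong toℕ cu≡) (toℕ-fromℕ< _) , a

module Collapse {n : ℕ} (G : Graph n) (acyclic : ¬ HasCycle G)
                {k : ℕ} (c : Fin n → Fin (2 + k)) (transitive : IsTransitivePartition G (2 + k) c) where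

  rank : Fin n → ℕ
  rank v = toℕ (c v)

  open Descents G rank

  x : Fin n
  x = proj₁ (proj₁ transitive (fromℕ (suc k)))

  rank-x : rank x ≡ suc k
  rank-x = trans (cong toℕ (proj₂ (proj₁ transitive (fromℕ (suc k))) refl)) (toℕ-fromℕ (suc k))

  <rank-x : ∀ {t} → t ≤ k → t < rank x
  <rank-x t≤k = subst (_ <_) (≡-sym rank-x) (s≤s t≤k)

  descend : ∀ {v t} → Descent x v → t < rank v → ∃ λ u → Descent x u × rank u ≡ t × Adj G u v
  descend {v} d t<v with neighbour-below G (proj₂ transitive) v t<v
  ... | u , refl , a = u , snoc d (Adj-sym G a) t<v , refl , a

  collapse : Fin n → Fin (suc k)
  collapse v with v Fin.≟ x | descent? x v | rank v <? k
  ... | yes _ | _     | _       = fromℕ k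
  ... | no _  | yes _ | yes v<k = fromℕ< (m<n⇒m<1+n v<k)
  ... | no _  | yes _ | no _    = Fin.zero
  ... | no _  | no _  | _       = Fin.zero

  data Collapsed (v : Fin n) : Fin (suc k) → Set where
    top    : v ≡ x → Collapsed v (fromℕ k)
    kept   : Descent x v → (v<k : rank v < k) → Collapsed v (fromℕ< (m<n⇒m<1+n v<k))
    bottom : Collapsed v Fin.zero

  collapsed : ∀ v → Collapsed v (collapse v)
  collapsed v with v Fin.≟ x | descent? x v | rank v <? k
  ... | yes v≡x | _     | _       = top v≡x
  ... | no _    | yes d | yes v<k = kept d v<k
  ... | no _    | yes _ | no _    = bottom
  ... | no _    | no _  | _       = bottom

  collapse-x : collapse x ≡ fromℕ k
  collapse-x with x Fin.≟ x
  ... | yes _  = refl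
  ... | no x≢x = ⊥-elim (x≢x refl)

  collapse-kept : ∀ {v i} → Descent x v → rank v ≡ toℕ i → toℕ i < k → collapse v ≡ i
  collapse-kept {v} d v≡i i<k with v Fin.≟ x | descent? x v | rank v <? k
  ... | yes refl | _     | _      =
    ⊥-elim (<-irrefl refl (<-trans (subst (_< k) (≡-sym v≡i) i<k) (<rank-x ≤-refl)))
  ... | no _     | yes _ | yes _  = toℕ-injective (trans (toℕ-fromℕ< _) v≡i)
  ... | no _     | no ¬d | _      = ⊥-elim (¬d d)
  ... | no _     | yes _ | no v≮k = ⊥-elim (v≮k (subst (_< k) (≡-sym v≡i) i<k))

  kept-neighbour : ∀ {v} i → Descent x v → toℕ i < rank v → toℕ i < k →
                   ∃ λ u → collapse u ≡ i × Adj G u v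
  kept-neighbour i d i<v i<k with descend d i<v
  ... | u , du , u≡i , a = u , collapse-kept du u≡i i<k , a

  collapse-surjective : IsPartition G (suc k) collapse
  collapse-surjective j with m<1+n⇒m<n∨m≡n (toℕ<n j)
  ... | inj₁ j<k with kept-neighbour j done (<rank-x (<⇒≤ j<k)) j<k
  ...   | u , cu≡j , _ = u , λ { refl → cu≡j }
  collapse-surjective j | inj₂ j≡k =
    x , λ { refl → trans collapse-x (toℕ-injective (trans (toℕ-fromℕ k) (≡-sym j≡k))) }

  collapse-dominates : ∀ i j → i Fin.< j → Dominates G collapse i j
  collapse-dominates i j i<j v cv≡j with subst (Collapsed v) cv≡j (collapsed v)
  ... | top refl = kept-neighbour i done (<rank-x (<⇒≤ i<k)) i<k
    where i<k = subst (toℕ i <_) (toℕ-fromℕ k) i<j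
  ... | kept d v<k = kept-neighbour i d i<v (<-trans i<v v<k)
    where i<v = subst (toℕ i <_) (toℕ-fromℕ< _) i<j
  ... | bottom with () ← i<j

  lower-not-dominated : ∀ {i j} → i Fin.< j → toℕ j < k → ¬ Dominates G collapse j i
  lower-not-dominated {i} i<j j<k dominates
    with descend done (<rank-x (<⇒≤ (<-trans i<j j<k)))
  ... | y , dy , y≡i , y~x with dominates y (collapse-kept dy y≡i (<-trans i<j j<k))
  ... | u , cu≡j , u~y with subst (Collapsed u) cu≡j (collapsed u)
  ... | top refl   = <-irrefl (toℕ-fromℕ k) j<k
  ... | kept d u<k =
    acyclic (descent-closed⇒cycle d (<rank-x (<⇒≤ u<k)) u~y
                                  (subst₂ _<_ (≡-sym y≡i) (toℕ-fromℕ< _) i<j) y~x)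
  ... | bottom with () ← i<j

  top-not-dominated : ∀ {i j} → toℕ i < k → toℕ j ≡ k → ¬ Dominates G collapse j i
  top-not-dominated {i} i<k j≡k dominates
    with descend done (<rank-x ≤-refl)
  ... | y , dy , y≡k , _ with descend dy (subst (toℕ i <_) (≡-sym y≡k) i<k)
  ... | z , dz , z≡i , z~y with dominates z (collapse-kept dz z≡i i<k)
  ... | u , cu≡j , u~z with subst (Collapsed u) cu≡j (collapsed u)
  ... | top refl   =
    acyclic (descent-closed⇒cycle dy (<rank-x (≤-reflexive y≡k)) (Adj-sym G z~y)
                                  (subst₂ _<_ (≡-sym z≡i) (≡-sym y≡k) i<k) (Adj-sym G u~z))
  ... | kept _ u<k = <-irrefl (trans (≡-sym (toℕ-fromℕ< _)) j≡k) u<k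
  ... | bottom     = n≮0 (subst (toℕ i <_) (≡-sym j≡k) i<k)

  collapse-not-dominated : ∀ i j → i Fin.< j → ¬ Dominates G collapse j i
  collapse-not-dominated i j i<j with m<1+n⇒m<n∨m≡n (toℕ<n j)
  ... | inj₁ j<k = lower-not-dominated i<j j<k
  ... | inj₂ j≡k = top-not-dominated (subst (toℕ i <_) j≡k i<j) j≡k

  tournament : IsTournamentTransitivePartition G (suc k) collapse
  tournament = (collapse-surjective , collapse-dominates) , collapse-not-dominated

transitive⇒tournament-transitive : ∀ {n k} (G : Graph n) → ¬ HasCycle G →
  HasTransitivePartition G (2 + k) → HasTournamentTransitivePartition G (1 + k)
transitive⇒tournament-transitive G acyclic (c , transitive) = collapse , tournament
  where open Collapse G acyclic c transitive

tournament-transitive⇒transitive : ∀ {n k} (G : Graph n) →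
  HasTournamentTransitivePartition G k → HasTransitivePartition G k
tournament-transitive⇒transitive G (c , transitive , _) = c , transitive

lemma3 : ∀ {n : ℕ} (T : Graph n) → IsTree T → ∀ (tr ttr : ℕ) → IsTransitivity T tr → IsTournamentTransitivity T ttr → (tr ∸ 1 ≤ ttr) × (ttr ≤ tr)
lemma3 T (_ , _ , acyclic) tr ttr (transitive , tr-max) (tournament , ttr-max) =
  pred≤ttr tr transitive , tr-max ttr (tournament-transitive⇒transitive T tournament)
  where
  pred≤ttr : ∀ k → HasTransitivePartition T k → k ∸ 1 ≤ ttr
  pred≤ttr 0             _ = z≤n
  pred≤ttr 1             _ = z≤n
  pred≤ttr (suc (suc k)) p = ttr-max (suc k) (transitive⇒tournament-transitive T acyclic p)
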